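{- Let $G=(V,E)$ be a graph and $f:V\to\{0,1,2\}$. Then $f$ is a minimal maximal Roman dominating function on $G$ if and only if all of the following hold: (1) $f$ is a maximal Roman dominating function; (2) for all $v\in V_1(f)$, $N(v)\cap V_2(f)=\emptyset$ or $V\setminus N[V_0(f)]\subseteq N[v]$; (3) for all $v\in V_2(f)$, $P_{G[V_0(f)\cup V_2(f)],V_2(f)}(v)\not\subseteq\{v\}$.
   Context: Graphs are finite, simple and undirected. $N(v)$ is the open neighborhood, $N[v]=N(v)\cup\{v\}$, $N[A]=\bigcup_{v\in A}N[v]$. For a graph $H$, $A\subseteq V(H)$ and $v\in A$, the private neighborhood is $P_{H,A}(v)=N_H[v]\setminus N_H[A\setminus\{v\}]$. For $f:V\to\{0,1,2\}$, $V_i(f)=\{v: f(v)=i\}$; $f\le g$ is pointwise. A maximal Roman dominating function (mRdf) on $G$ is an $f:V\to\{0,1,2\}$ such that $N(v)\cap V_2(f)\ne\emptyset$ for every $v\in V_0(f)$ and $N[V_0(f)]\ne V$ (i.e. $V_0(f)$ is not a dominating set). It is minimal if no mRdf $g\le f$ with $g\ne f$ exists. -}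

module Defs where

open import Data.Nat using (ℕ)
open import Data.Fin using (Fin)
open import Data.Bool using (Bool; true; false)
open import Data.Product using (Σ; ∃; _×_; _,_)
open import Data.Sum using (_⊎_)
open import Relation.Nullary using (¬_)
open import Relation.Binary.PropositionalEquality using (_≡_; _≢_)

record Graph : Set where
  field
    n     : ℕ
    adj   : Fin n → Fin n → Bool
    sym   : ∀ u v → adj u v ≡ adj v u
    irrefl : ∀ v → adj v v ≡ false

open Graph public

module _ (G : Graph) where
  V : Set
  V = Fin (n G)

  Adj : V → V → Set
  Adj v u = adj G v u ≡ true

  VSet : Set₁
  VSet = V → Set

  NC : V → VSet
  NC v u = (u ≡ v) ⊎ Adj v u

  NCs : VSet → VSet
  NCs A u = Σ V λ v → A v × NC v u

  NCInd : VSet → V → VSet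
  NCInd S v u = S u × S v × NC v u

  NCsInd : VSet → VSet → VSet
  NCsInd S A u = Σ V λ v → A v × NCInd S v u

  Priv : VSet → VSet → V → VSet
  Priv S A v u = NCInd S v u × ¬ NCsInd S (λ w → A w × w ≢ v) u

data Lab : Set where
  l0 l1 l2 : Lab

data _≤L_ : Lab → Lab → Set where
  l0≤ : ∀ {a} → l0 ≤L a
  l1≤l1 : l1 ≤L l1
  l1≤l2 : l1 ≤L l2
  l2≤l2 : l2 ≤L l2

module _ (G : Graph) where
  Func : Set
  Func = V G → Lab

  Vi : Func → Lab → VSet G
  Vi f i v = f v ≡ i

  _≤F_ : Func → Func → Set
  g ≤F f = ∀ v → g v ≤L f v

  IsMRDF : Func → Set
  IsMRDF f = (∀ v → f v ≡ l0 → Σ (V G) λ u → Adj G v u × f u ≡ l2)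
           × ¬ (∀ u → NCs G (Vi f l0) u)

  IsMinMRDF : Func → Set
  IsMinMRDF f = IsMRDF f
              × ¬ (Σ Func λ g → IsMRDF g × g ≤F f × ¬ (∀ v → g v ≡ f v))

-- Since the graph is finite, every membership question below is decidable, so the argument may be
-- classical. Minimality is tested only by lowering one value at a time: turning a 1 into 0 keeps the
-- Roman property exactly when the vertex sees a 2, and keeps V₀ non-dominating unless it covers what
-- N[V₀] misses, which gives (2); turning a 2 into 1 keeps the Roman property exactly when every 0
-- next to it has another 2-neighbour, i.e. when its private neighbourhood in G[V₀ ∪ V₂] is at most
-- itself, which gives (3). Conversely, if g ≤ f is an mRdf then (3) forces V₂(g) = V₂(f), and a
-- vertex with f = 1, g = 0 would see a 2 of f, so by (2) V₀(g) would dominate G; hence g = f.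
module Submission where

open import Defs hiding (sym)
open import Data.Bool using (true; false)
open import Data.Empty using (⊥; ⊥-elim)
open import Data.Fin using (_≟_)
open import Data.Fin.Properties using (any?)
open import Data.Product using (Σ; _×_; _,_; proj₁)
open import Data.Sum using (_⊎_; inj₁; inj₂)
open import Function.Bundles using (_⇔_; mk⇔)
open import Relation.Binary.Definitions using (DecidableEquality)
open import Relation.Binary.PropositionalEquality using (_≡_; _≢_; refl; sym; trans; subst)
open import Relation.Nullary using (¬_; yes; no)
open import Relation.Nullary.Decidable using (_×-dec_; _⊎-dec_; ¬?; decidable-stable)
open import Relation.Unary using (Decidable; _⊆_)

_≟L_ : DecidableEquality Lab
l0 ≟L l0 = yes refl
l0 ≟L l1 = no λ ()
l0 ≟L l2 = no λ ()
l1 ≟L l0 = no λ ()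
l1 ≟L l1 = yes refl
l1 ≟L l2 = no λ ()
l2 ≟L l0 = no λ ()
l2 ≟L l1 = no λ ()
l2 ≟L l2 = yes refl

l0≢l1 : l0 ≢ l1
l0≢l1 ()

l1≢l2 : l1 ≢ l2
l1≢l2 ()

≤L-refl : ∀ a → a ≤L a
≤L-refl l0 = l0≤
≤L-refl l1 = l1≤l1
≤L-refl l2 = l2≤l2

≤L-l0 : ∀ {a b} → a ≤L b → b ≡ l0 → a ≡ l0
≤L-l0 l0≤ _ = refl

≤L-l1 : ∀ {a b} → a ≤L b → b ≡ l1 → a ≢ l0 → a ≡ l1
≤L-l1 l0≤   _ a≢l0 = ⊥-elim (a≢l0 refl)
≤L-l1 l1≤l1 _ _    = refl

l2-≤L : ∀ {a b} → a ≤L b → a ≡ l2 → b ≡ l2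
l2-≤L l2≤l2 _ = refl

module _ (G : Graph) where

  Adj? : ∀ v → Decidable (Adj G v)
  Adj? v u with adj G v u
  ... | true  = yes refl
  ... | false = no λ ()

  Adj-sym : ∀ {v u} → Adj G v u → Adj G u v
  Adj-sym {v} {u} = trans (Graph.sym G u v)

  NC? : ∀ v → Decidable (NC G v)
  NC? v u = (u ≟ v) ⊎-dec Adj? v u

  NCs? : ∀ {A} → Decidable A → Decidable (NCs G A)
  NCs? A? u = any? λ v → A? v ×-dec NC? v u

  NCs-mono : ∀ {A B} → A ⊆ B → NCs G A ⊆ NCs G B
  NCs-mono A⊆B (v , v∈A , u∈N[v]) = v , A⊆B v∈A , u∈N[v]

  Dominates : VSet G → Set
  Dominates A = ∀ u → NCs G A u

  Roman : Func G → Set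
  Roman f = ∀ v → f v ≡ l0 → Σ (V G) λ u → Adj G v u × f u ≡ l2

  NoTwoNeighbour : Func G → V G → Set
  NoTwoNeighbour f v = ∀ u → Adj G v u → f u ≢ l2

  CoversUndominated : Func G → V G → Set
  CoversUndominated f v = ∀ u → ¬ NCs G (Vi G f l0) u → NC G v u

  OnlySelfPrivate : Func G → V G → Set
  OnlySelfPrivate f v =
    ∀ u → Priv G (λ w → (f w ≡ l0) ⊎ (f w ≡ l2)) (Vi G f l2) v u → u ≡ v

  -- Splitting on x ≟ v later also makes (f [ v ≔ a ]) x compute in hypotheses.
  _[_≔_] : Func G → V G → Lab → Func G
  (f [ v ≔ a ]) x with x ≟ v
  ... | yes _ = a
  ... | no  _ = f x

  update-at : ∀ f v a → (f [ v ≔ a ]) v ≡ a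
  update-at f v a with v ≟ v
  ... | yes _   = refl
  ... | no  v≢v = ⊥-elim (v≢v refl)

  update-elsewhere : ∀ f {v} a {x} → x ≢ v → (f [ v ≔ a ]) x ≡ f x
  update-elsewhere f {v} a {x} x≢v with x ≟ v
  ... | yes x≡v = ⊥-elim (x≢v x≡v)
  ... | no  _   = refl

  update-≤F : ∀ f v {a} → a ≤L f v → _≤F_ G (f [ v ≔ a ]) f
  update-≤F f v a≤fv x with x ≟ v
  ... | yes refl = a≤fv
  ... | no  _    = ≤L-refl (f x)

  IsMinMRDF-update : ∀ {f} → IsMinMRDF G f →
    ∀ v {a} → a ≤L f v → a ≢ f v → ¬ IsMRDF G (f [ v ≔ a ])
  IsMinMRDF-update {f} (_ , minimal) v {a} a≤fv a≢fv g-mrdf =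
    minimal (f [ v ≔ a ] , g-mrdf , update-≤F f v a≤fv ,
             λ g≡f → a≢fv (trans (sym (update-at f v a)) (g≡f v)))

  IsMRDF-lower-to-l0 : ∀ {f v w u} → IsMRDF G f → f v ≢ l2 → Adj G v w → f w ≡ l2 →
    ¬ NCs G (Vi G f l0) u → ¬ NC G v u → IsMRDF G (f [ v ≔ l0 ])
  IsMRDF-lower-to-l0 {f} {v} {w} {u} (roman , nondom) fv≢l2 v~w fw≡l2 u∉N[V₀] u∉N[v] =
    roman′ , nondom′
    where
    off-v : ∀ {y} → f y ≡ l2 → y ≢ v
    off-v fy≡l2 refl = fv≢l2 fy≡l2

    roman′ : Roman (f [ v ≔ l0 ])
    roman′ x gx≡l0 with x ≟ v
    ... | yes refl = w , v~w , trans (update-elsewhere f l0 (off-v fw≡l2)) fw≡l2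
    ... | no  _ with roman x gx≡l0
    ...   | y , x~y , fy≡l2 = y , x~y , trans (update-elsewhere f l0 (off-v fy≡l2)) fy≡l2

    nondom′ : ¬ Dominates (Vi G (f [ v ≔ l0 ]) l0)
    nondom′ dom with dom u
    ... | z , gz≡l0 , u∈N[z] with z ≟ v
    ...   | yes refl = u∉N[v] u∈N[z]
    ...   | no  _    = u∉N[V₀] (z , gz≡l0 , u∈N[z])

  -- A 0 next to v with no other 2-neighbour would be a private neighbour of v other than v.
  IsMRDF-lower-to-l1 : ∀ {f v} → IsMRDF G f → f v ≡ l2 → OnlySelfPrivate f v →
    IsMRDF G (f [ v ≔ l1 ])
  IsMRDF-lower-to-l1 {f} {v} (roman , nondom) fv≡l2 only-self = roman′ , nondom′
    where
    V₀-shrinks : Vi G (f [ v ≔ l1 ]) l0 ⊆ Vi G f l0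
    V₀-shrinks {x} gx≡l0 with x ≟ v
    V₀-shrinks {x} () | yes refl
    V₀-shrinks {x} gx≡l0 | no _ = gx≡l0

    nondom′ : ¬ Dominates (Vi G (f [ v ≔ l1 ]) l0)
    nondom′ dom = nondom λ u → NCs-mono V₀-shrinks (dom u)

    roman′ : Roman (f [ v ≔ l1 ])
    roman′ x gx≡l0 with x ≟ v
    roman′ x () | yes refl
    roman′ x gx≡l0 | no x≢v with any? (λ y → Adj? x y ×-dec (f y ≟L l2) ×-dec ¬? (y ≟ v))
    ... | yes (y , x~y , fy≡l2 , y≢v) = y , x~y , trans (update-elsewhere f l1 y≢v) fy≡l2
    ... | no  no-other = ⊥-elim (x≢v (only-self x ((inj₁ gx≡l0 , inj₂ fv≡l2 , inj₂ v~x) , unshared)))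
      where
      v~x : Adj G v x
      v~x with roman x gx≡l0
      ... | y , x~y , fy≡l2 with y ≟ v
      ...   | yes refl = Adj-sym x~y
      ...   | no  y≢v  = ⊥-elim (no-other (y , x~y , fy≡l2 , y≢v))

      unshared : ¬ NCsInd G _ (λ w → Vi G f l2 w × w ≢ v) x
      unshared (y , (fy≡l2 , y≢v) , _ , _ , inj₁ refl) with trans (sym gx≡l0) fy≡l2
      ... | ()
      unshared (y , (fy≡l2 , y≢v) , _ , _ , inj₂ y~x) = no-other (y , Adj-sym y~x , fy≡l2 , y≢v)

  Roman-below-keeps-l2 : ∀ {f g} → Roman g → _≤F_ G g f →
    ∀ {x} → ¬ OnlySelfPrivate f x → g x ≡ l2
  Roman-below-keeps-l2 {f} {g} roman g≤f {x} has-private =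
    decidable-stable (g x ≟L l2) λ gx≢l2 → has-private (only-self gx≢l2)
    where
    only-self : g x ≢ l2 → OnlySelfPrivate f x
    only-self _ u _ with u ≟ x
    only-self _ u _                                      | yes u≡x = u≡x
    only-self _ u ((_ , _ , inj₁ u≡x) , _)               | no  u≢x = ⊥-elim (u≢x u≡x)
    only-self _ u ((inj₂ fu≡l2 , _ , inj₂ _) , unshared) | no  u≢x =
      ⊥-elim (unshared (u , (fu≡l2 , u≢x) , inj₂ fu≡l2 , inj₂ fu≡l2 , inj₁ refl))
    only-self gx≢l2 u ((inj₁ fu≡l0 , _ , inj₂ _) , unshared) | no _
      with roman u (≤L-l0 (g≤f u) fu≡l0)
    ... | w , u~w , gw≡l2 =
      ⊥-elim (unshared (w , (fw≡l2 , w≢x) , inj₁ fu≡l0 , inj₂ fw≡l2 , inj₂ (Adj-sym u~w)))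
      where
      fw≡l2 : f w ≡ l2
      fw≡l2 = l2-≤L (g≤f w) gw≡l2

      w≢x : w ≢ x
      w≢x refl = gx≢l2 gw≡l2

  IsMRDF-below-keeps-l1 : ∀ {f g} → IsMRDF G g → _≤F_ G g f →
    ∀ {x} → f x ≡ l1 → NoTwoNeighbour f x ⊎ CoversUndominated f x → g x ≡ l1
  IsMRDF-below-keeps-l1 {f} {g} (roman , nondom) g≤f {x} fx≡l1 condition =
    ≤L-l1 (g≤f x) fx≡l1 λ gx≡l0 → lowered gx≡l0 (roman x gx≡l0) condition
    where
    lowered : g x ≡ l0 → Σ (V G) (λ w → Adj G x w × g w ≡ l2) →
      NoTwoNeighbour f x ⊎ CoversUndominated f x → ⊥
    lowered _     (w , x~w , gw≡l2) (inj₁ no-two) = no-two w x~w (l2-≤L (g≤f w) gw≡l2)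
    lowered gx≡l0 _                 (inj₂ covers) = nondom dominated
      where
      dominated : Dominates (Vi G g l0)
      dominated u with NCs? (λ z → f z ≟L l0) u
      ... | yes u∈N[V₀f] = NCs-mono (λ {z} → ≤L-l0 (g≤f z)) u∈N[V₀f]
      ... | no  u∉N[V₀f] = x , gx≡l0 , covers u u∉N[V₀f]

  IsMRDF-below-≡ : ∀ {f g} → IsMRDF G g → _≤F_ G g f →
    (∀ v → f v ≡ l1 → NoTwoNeighbour f v ⊎ CoversUndominated f v) →
    (∀ v → f v ≡ l2 → ¬ OnlySelfPrivate f v) →
    ∀ x → g x ≡ f x
  IsMRDF-below-≡ {f} g-mrdf g≤f condition₂ condition₃ x with f x in fx
  ... | l0 = ≤L-l0 (g≤f x) fx
  ... | l1 = IsMRDF-below-keeps-l1 g-mrdf g≤f fx (condition₂ x fx)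
  ... | l2 = Roman-below-keeps-l2 (proj₁ g-mrdf) g≤f (condition₃ x fx)

  IsMinMRDF-condition₂ : ∀ {f} → IsMinMRDF G f →
    ∀ v → f v ≡ l1 → NoTwoNeighbour f v ⊎ CoversUndominated f v
  IsMinMRDF-condition₂ {f} min v fv≡l1 with any? (λ w → Adj? v w ×-dec (f w ≟L l2))
  ... | no  none = inj₁ λ w v~w fw≡l2 → none (w , v~w , fw≡l2)
  ... | yes (w , v~w , fw≡l2) = inj₂ λ u u∉N[V₀] →
    decidable-stable (NC? v u) λ u∉N[v] →
      IsMinMRDF-update min v l0≤ (λ l0≡fv → l0≢l1 (trans l0≡fv fv≡l1))
        (IsMRDF-lower-to-l0 (proj₁ min) (λ fv≡l2 → l1≢l2 (trans (sym fv≡l1) fv≡l2))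
           v~w fw≡l2 u∉N[V₀] u∉N[v])

  IsMinMRDF-condition₃ : ∀ {f} → IsMinMRDF G f → ∀ v → f v ≡ l2 → ¬ OnlySelfPrivate f v
  IsMinMRDF-condition₃ {f} min v fv≡l2 only-self =
    IsMinMRDF-update min v (subst (l1 ≤L_) (sym fv≡l2) l1≤l2) (λ l1≡fv → l1≢l2 (trans l1≡fv fv≡l2))
      (IsMRDF-lower-to-l1 (proj₁ min) fv≡l2 only-self)

theorem2 : (G : Graph) (f : Func G) →
    IsMinMRDF G f ⇔
      ( IsMRDF G f
      × (∀ v → f v ≡ l1 →
           (∀ u → Adj G v u → f u ≢ l2)
           ⊎ (∀ u → ¬ NCs G (Vi G f l0) u → NC G v u))
      × (∀ v → f v ≡ l2 →
           ¬ (∀ u → Priv G (λ w → (f w ≡ l0) ⊎ (f w ≡ l2)) (Vi G f l2) v u → u ≡ v)) )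
theorem2 G f = mk⇔
  (λ min → proj₁ min , IsMinMRDF-condition₂ G min , IsMinMRDF-condition₃ G min)
  (λ (mrdf , condition₂ , condition₃) → mrdf , λ (g , g-mrdf , g≤f , g≢f) →
     g≢f (IsMRDF-below-≡ G g-mrdf g≤f condition₂ condition₃))
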